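{- Let $G$ be a finite simple graph. If there is an independent set $S$ in $G$ such that $|N(A)\cap S|=2|A|$ holds for every independent set $A\subseteq V(G)\setminus S$, then the independence polynomial $I(G;x)$ is symmetric and unimodal.
   Context: For a finite simple graph $G$, $i_k(G)$ is the number of independent sets of size $k$ ($i_0(G)=1$), $\alpha(G)$ is the maximum size of an independent set, and $I(G;x)=\sum_{k=0}^{\alpha(G)} i_k(G)x^k$. For $A\subseteq V(G)$, $N(A)$ is the set of vertices adjacent to at least one vertex of $A$. A polynomial $\sum_{k=0}^n a_kx^k$ of degree $n$ with nonnegative coefficients is symmetric if $a_k=a_{n-k}$ for all $0\le k\le n$, and unimodal if there is $m$ with $a_0\le\cdots\le a_m\ge\cdots\ge a_n$. -}

module Defs where

open import Data.Nat using (ℕ; zero; suc; _≤_; _<_; _∸_; _⊔_)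
open import Data.Bool using (Bool; true; false)
open import Data.Fin using (Fin)
open import Data.Fin.Subset using (Subset; _∈_; _∉_; _∩_; ∣_∣; outside; inside)
open import Data.Fin.Subset.Properties using (_∈?_)
open import Data.Fin.Properties using (all?; any?)
open import Data.Vec using (Vec; []; _∷_; tabulate)
open import Data.List using (List; []; _∷_; map; _++_; filter; length; foldr)
open import Data.Product using (∃-syntax; _×_; _,_)
open import Relation.Nullary using (¬_; Dec; yes; no; does)
open import Relation.Nullary.Decidable using (_→-dec_; ¬?; _×-dec_)
open import Relation.Binary.PropositionalEquality using (_≡_)
open import Data.Nat.Properties using (_≟_)
open import Data.Bool.Properties using () renaming (_≟_ to _≟ᵇ_)

record Graph (n : ℕ) : Set where
  field
    adj    : Fin n → Fin n → Bool
    sym    : ∀ u v → adj u v ≡ adj v u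
    irrefl : ∀ v → adj v v ≡ false
open Graph public

Adj : ∀ {n} → Graph n → Fin n → Fin n → Set
Adj G u v = adj G u v ≡ true

Independent : ∀ {n} → Graph n → Subset n → Set
Independent G A = ∀ u v → u ∈ A → v ∈ A → ¬ Adj G u v

independent? : ∀ {n} (G : Graph n) (A : Subset n) → Dec (Independent G A)
independent? G A =
  all? λ u → all? λ v → (u ∈? A) →-dec ((v ∈? A) →-dec ¬? (adj G u v ≟ᵇ true))

N : ∀ {n} → Graph n → Subset n → Subset n
N G A = tabulate λ v → does (any? λ u → (u ∈? A) ×-dec (adj G u v ≟ᵇ true))

allSubsets : (n : ℕ) → List (Subset n)
allSubsets zero    = [] ∷ []
allSubsets (suc n) = map (outside ∷_) (allSubsets n) ++ map (inside ∷_) (allSubsets n)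

indepCount : ∀ {n} → Graph n → ℕ → ℕ
indepCount {n} G k =
  length (filter (λ A → independent? G A ×-dec (∣ A ∣ ≟ k)) (allSubsets n))

α : ∀ {n} → Graph n → ℕ
α {n} G = foldr (λ A m → ∣ A ∣ ⊔ m) 0 (filter (independent? G) (allSubsets n))

-- I(G;x) = Σ_{k=0}^{α(G)} i_k(G) x^k has degree α(G) (i_{α(G)} ≥ 1).
-- Symmetric: a_k = a_{α-k} for 0 ≤ k ≤ α.
Symmetric : ∀ {n} → Graph n → Set
Symmetric G = ∀ k → k ≤ α G → indepCount G k ≡ indepCount G (α G ∸ k)

Unimodal : ∀ {n} → Graph n → Set
Unimodal G = ∃[ m ] (m ≤ α G
  × (∀ k → suc k ≤ m → indepCount G k ≤ indepCount G (suc k))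
  × (∀ k → m ≤ k → suc k ≤ α G → indepCount G (suc k) ≤ indepCount G k))

module Submission where

-- Write s = |S| and split every set X ⊆ V(G) as X = A ∪ B with
-- A = X ∖ S and B = X ∩ S.  As S is independent, A ∪ B is independent exactly
-- when A is independent and B avoids N(A), and by hypothesis S ∖ N(A) has
-- s - 2|A| elements.  Hence
--     I(G;x) = Σ_{A ⊆ V ∖ S independent} x^|A| (1+x)^(s - 2|A|).
-- Every summand has coefficients that are palindromic about s (c_k = c_{s-k})
-- and ascending on the lower half [0, s/2], because binomial coefficients are;
-- both properties survive summation.  The coefficients vanish above s while S
-- itself is independent, so α(G) = s, and a palindromic sequence ascending on
-- its lower half is unimodal with mode ⌊s/2⌋.

open import Data.Nat using (ℕ; zero; suc; _+_; _*_; _∸_; _≤_; _<_; _⊔_; z≤n; s≤s; ⌊_/2⌋)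
open import Data.Nat.Properties
open import Data.Nat.Combinatorics using (_C_; nCk≡nC[n∸k]; k>n⇒nCk≡0; nC1≡n; nCk+nC[k+1]≡[n+1]C[k+1])
open import Data.Bool using (true; false; if_then_else_)
open import Data.Fin.Subset using (Subset; _∩_; _∪_; ∣_∣; _⊆_; ∁; outside; inside; _∈_)
open import Data.Fin.Subset.Properties
  using (_⊆?_; p⊆p∪q; q⊆p∪q; x∈p∪q⁻; x∈∁p⇒x∉p; x∉p⇒x∈∁p; ∣p∩q∣≤∣q∣; drop-∷-⊆; out⊆; in⊆in)
open import Data.Fin.Properties using (any?)
open import Data.Vec using ([]; _∷_) renaming (here to head∈)
open import Data.Vec.Properties using (lookup∘tabulate; []=⇒lookup; lookup⇒[]=)
open import Data.List using (List; []; _∷_; map; _++_; filter; length; foldr)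
open import Data.List.Properties using (filter-some)
open import Data.List.Membership.Propositional using (lose) renaming (_∈_ to _∈L_)
open import Data.List.Membership.Propositional.Properties
  using (∈-map⁻; ∈-map⁺; ∈-++⁻; ∈-++⁺ˡ; ∈-++⁺ʳ; ∈-filter⁺; ∈-filter⁻)
open import Data.List.Relation.Unary.Any using (here; there)
open import Data.Product using (∃-syntax; _×_; _,_; proj₂)
open import Data.Sum using (inj₁; inj₂)
open import Function using (_∘_)
open import Level using (0ℓ)
open import Relation.Nullary using (¬_; Dec; yes; no; does; contradiction)
open import Relation.Nullary.Decidable using (_×-dec_)
open import Relation.Unary using (Pred; Decidable)
open import Relation.Binary.PropositionalEquality
open import Algebra.Properties.CommutativeSemigroup +-commutativeSemigroup using (interchange)
open import Defs hiding (sym)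

∑ : {A : Set} → List A → (A → ℕ) → ℕ
∑ []       f = 0
∑ (x ∷ xs) f = f x + ∑ xs f

infixr 7 ∑
syntax ∑ xs (λ x → e) = ∑[ x ← xs ] e

module _ {A : Set} where

  ∑-++ : (xs ys : List A) (f : A → ℕ) → ∑ (xs ++ ys) f ≡ ∑ xs f + ∑ ys f
  ∑-++ []       ys f = refl
  ∑-++ (x ∷ xs) ys f = trans (cong (f x +_) (∑-++ xs ys f)) (sym (+-assoc (f x) _ _))

  ∑-map : {B : Set} (xs : List B) (h : B → A) (f : A → ℕ) → ∑ (map h xs) f ≡ ∑ xs (f ∘ h)
  ∑-map []       h f = refl
  ∑-map (x ∷ xs) h f = cong (f (h x) +_) (∑-map xs h f)

  ∑-cong : (xs : List A) {f g : A → ℕ} → (∀ {x} → x ∈L xs → f x ≡ g x) → ∑ xs f ≡ ∑ xs g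
  ∑-cong []       f≡g = refl
  ∑-cong (x ∷ xs) f≡g = cong₂ _+_ (f≡g (here refl)) (∑-cong xs (f≡g ∘ there))

  ∑-mono : (xs : List A) {f g : A → ℕ} → (∀ {x} → x ∈L xs → f x ≤ g x) → ∑ xs f ≤ ∑ xs g
  ∑-mono []       f≤g = z≤n
  ∑-mono (x ∷ xs) f≤g = +-mono-≤ (f≤g (here refl)) (∑-mono xs (f≤g ∘ there))

  ∑-zero : (xs : List A) {f : A → ℕ} → (∀ x → f x ≡ 0) → ∑ xs f ≡ 0
  ∑-zero []       f≡0 = refl
  ∑-zero (x ∷ xs) f≡0 = cong₂ _+_ (f≡0 x) (∑-zero xs f≡0)

  ∑-+ : (xs : List A) (f g : A → ℕ) → ∑[ x ← xs ] (f x + g x) ≡ ∑ xs f + ∑ xs g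
  ∑-+ []       f g = refl
  ∑-+ (x ∷ xs) f g = trans (cong (f x + g x +_) (∑-+ xs f g)) (interchange (f x) (g x) _ _)

𝟙 : {P : Set} → Dec P → ℕ
𝟙 d = if does d then 1 else 0

𝟙-cong : {P Q : Set} → (P → Q) → (Q → P) → (p : Dec P) (q : Dec Q) → 𝟙 p ≡ 𝟙 q
𝟙-cong P→Q Q→P (yes p) (yes q) = refl
𝟙-cong P→Q Q→P (yes p) (no ¬q) = contradiction (P→Q p) ¬q
𝟙-cong P→Q Q→P (no ¬p) (yes q) = contradiction (Q→P q) ¬p
𝟙-cong P→Q Q→P (no ¬p) (no ¬q) = refl

𝟙-false : {P : Set} → ¬ P → (p : Dec P) → 𝟙 p ≡ 0
𝟙-false ¬p (yes p) = contradiction p ¬p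
𝟙-false ¬p (no _)  = refl

length-filter≡∑𝟙 : {A : Set} {P : Pred A 0ℓ} (P? : Decidable P) (xs : List A) →
  length (filter P? xs) ≡ ∑[ x ← xs ] 𝟙 (P? x)
length-filter≡∑𝟙 P? []       = refl
length-filter≡∑𝟙 P? (x ∷ xs) with does (P? x)
... | true  = cong suc (length-filter≡∑𝟙 P? xs)
... | false = length-filter≡∑𝟙 P? xs

maxOver : {A : Set} → (A → ℕ) → List A → ℕ
maxOver f = foldr (λ x m → f x ⊔ m) 0

maxOver-upper : {A : Set} (f : A → ℕ) (xs : List A) {x : A} → x ∈L xs → f x ≤ maxOver f xs
maxOver-upper f (y ∷ xs) (here refl) = m≤m⊔n (f y) _
maxOver-upper f (y ∷ xs) (there x∈) = ≤-trans (maxOver-upper f xs x∈) (m≤n⊔m (f y) _)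

maxOver-least : {A : Set} (f : A → ℕ) (xs : List A) {b : ℕ} →
  (∀ {x} → x ∈L xs → f x ≤ b) → maxOver f xs ≤ b
maxOver-least f []       bound = z≤n
maxOver-least f (x ∷ xs) bound = ⊔-lub (bound (here refl)) (maxOver-least f xs (bound ∘ there))

subsetsOf : ∀ {n} → Subset n → List (Subset n)
subsetsOf []            = [] ∷ []
subsetsOf (outside ∷ M) = map (outside ∷_) (subsetsOf M)
subsetsOf (inside ∷ M)  = map (outside ∷_) (subsetsOf M) ++ map (inside ∷_) (subsetsOf M)

∈subsetsOf⇒⊆ : ∀ {n} (M : Subset n) {X : Subset n} → X ∈L subsetsOf M → X ⊆ M
∈subsetsOf⇒⊆ [] (here refl) ()
∈subsetsOf⇒⊆ (outside ∷ M) X∈ with ∈-map⁻ (outside ∷_) X∈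
... | _ , Y∈ , refl = out⊆ (∈subsetsOf⇒⊆ M Y∈)
∈subsetsOf⇒⊆ (inside ∷ M) X∈ with ∈-++⁻ (map (outside ∷_) (subsetsOf M)) X∈
... | inj₁ X∈out with ∈-map⁻ (outside ∷_) X∈out
...   | _ , Y∈ , refl = out⊆ (∈subsetsOf⇒⊆ M Y∈)
∈subsetsOf⇒⊆ (inside ∷ M) X∈ | inj₂ X∈in with ∈-map⁻ (inside ∷_) X∈in
...   | _ , Y∈ , refl = in⊆in (∈subsetsOf⇒⊆ M Y∈)

∈allSubsets : ∀ {n} (X : Subset n) → X ∈L allSubsets n
∈allSubsets []            = here refl
∈allSubsets (outside ∷ X) = ∈-++⁺ˡ (∈-map⁺ (outside ∷_) (∈allSubsets X))
∈allSubsets (inside ∷ X)  = ∈-++⁺ʳ (map (outside ∷_) (allSubsets _)) (∈-map⁺ (inside ∷_) (∈allSubsets X))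

∑-branch : ∀ {n} (xs ys : List (Subset n)) (f : Subset (suc n) → ℕ) →
  ∑ (map (outside ∷_) xs ++ map (inside ∷_) ys) f
    ≡ ∑[ X ← xs ] f (outside ∷ X) + ∑[ Y ← ys ] f (inside ∷ Y)
∑-branch xs ys f = trans (∑-++ (map (outside ∷_) xs) _ f) (cong₂ _+_ (∑-map xs _ f) (∑-map ys _ f))

-- Every X ⊆ V is uniquely A ∪ B with A ⊆ ∁ S and B ⊆ S.
∑-decompose : ∀ {n} (S : Subset n) (f : Subset n → ℕ) →
  ∑ (allSubsets n) f ≡ ∑[ A ← subsetsOf (∁ S) ] ∑[ B ← subsetsOf S ] f (A ∪ B)
∑-decompose []           f = cong (_+ 0) (sym (+-identityʳ (f [])))
∑-decompose {suc n} (inside ∷ S) f = begin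
    ∑ (allSubsets (suc n)) f
  ≡⟨ ∑-branch (allSubsets n) (allSubsets n) f ⟩
    ∑[ X ← allSubsets n ] f (outside ∷ X) + ∑[ X ← allSubsets n ] f (inside ∷ X)
  ≡⟨ cong₂ _+_ (∑-decompose S _) (∑-decompose S _) ⟩
    ∑[ A ← Ā ] ∑[ B ← B̄ ] f (outside ∷ (A ∪ B)) + ∑[ A ← Ā ] ∑[ B ← B̄ ] f (inside ∷ (A ∪ B))
  ≡⟨ ∑-+ Ā _ _ ⟨
    ∑[ A ← Ā ] (∑[ B ← B̄ ] f (outside ∷ (A ∪ B)) + ∑[ B ← B̄ ] f (inside ∷ (A ∪ B)))
  ≡⟨ ∑-cong Ā (λ _ → ∑-branch B̄ B̄ _) ⟨
    ∑[ A ← Ā ] ∑[ B ← subsetsOf (inside ∷ S) ] f ((outside ∷ A) ∪ B)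
  ≡⟨ ∑-map Ā _ _ ⟨
    ∑[ A ← subsetsOf (∁ (inside ∷ S)) ] ∑[ B ← subsetsOf (inside ∷ S) ] f (A ∪ B)
  ∎ where
    open ≡-Reasoning
    Ā B̄ : List (Subset n)
    Ā = subsetsOf (∁ S)
    B̄ = subsetsOf S
∑-decompose {suc n} (outside ∷ S) f = begin
    ∑ (allSubsets (suc n)) f
  ≡⟨ ∑-branch (allSubsets n) (allSubsets n) f ⟩
    ∑[ X ← allSubsets n ] f (outside ∷ X) + ∑[ X ← allSubsets n ] f (inside ∷ X)
  ≡⟨ cong₂ _+_ (∑-decompose S _) (∑-decompose S _) ⟩
    ∑[ A ← Ā ] ∑[ B ← B̄ ] f (outside ∷ (A ∪ B)) + ∑[ A ← Ā ] ∑[ B ← B̄ ] f (inside ∷ (A ∪ B))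
  ≡⟨ cong₂ _+_ (∑-cong Ā (λ _ → ∑-map B̄ _ _)) (∑-cong Ā (λ _ → ∑-map B̄ _ _)) ⟨
    ∑[ A ← Ā ] ∑[ B ← subsetsOf (outside ∷ S) ] f ((outside ∷ A) ∪ B)
      + ∑[ A ← Ā ] ∑[ B ← subsetsOf (outside ∷ S) ] f ((inside ∷ A) ∪ B)
  ≡⟨ ∑-branch Ā Ā _ ⟨
    ∑[ A ← subsetsOf (∁ (outside ∷ S)) ] ∑[ B ← subsetsOf (outside ∷ S) ] f (A ∪ B)
  ∎ where
    open ≡-Reasoning
    Ā B̄ : List (Subset n)
    Ā = subsetsOf (∁ S)
    B̄ = subsetsOf S

∑-restrict : ∀ {n} (M R : Subset n) (g : Subset n → ℕ) →
  ∑[ B ← subsetsOf M ] (if does (B ⊆? R) then g B else 0) ≡ ∑[ B ← subsetsOf (M ∩ R) ] g B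
∑-restrict []            []            g = refl
∑-restrict (outside ∷ M) (r ∷ R)       g =
  trans (∑-map (subsetsOf M) _ _) (trans (∑-restrict M R _) (sym (∑-map (subsetsOf (M ∩ R)) _ g)))
∑-restrict (inside ∷ M)  (inside ∷ R)  g =
  trans (∑-branch (subsetsOf M) (subsetsOf M) _)
    (trans (cong₂ _+_ (∑-restrict M R _) (∑-restrict M R _))
      (sym (∑-branch (subsetsOf (M ∩ R)) (subsetsOf (M ∩ R)) g)))
∑-restrict (inside ∷ M)  (outside ∷ R) g =
  trans (∑-branch (subsetsOf M) (subsetsOf M) _)
    (trans (cong₂ _+_ (∑-restrict M R _) (∑-zero (subsetsOf M) (λ _ → refl)))
      (trans (+-identityʳ _) (sym (∑-map (subsetsOf (M ∩ R)) _ g))))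

∑-size≡C : ∀ {n} (M : Subset n) (k : ℕ) → ∑[ B ← subsetsOf M ] 𝟙 (∣ B ∣ ≟ k) ≡ ∣ M ∣ C k
∑-size≡C []            zero    = refl
∑-size≡C []            (suc k) = refl
∑-size≡C (outside ∷ M) k       = trans (∑-map (subsetsOf M) _ _) (∑-size≡C M k)
∑-size≡C (inside ∷ M)  zero    =
  trans (∑-branch (subsetsOf M) (subsetsOf M) _)
    (cong₂ _+_ (∑-size≡C M 0) (∑-zero (subsetsOf M) (λ _ → refl)))
∑-size≡C (inside ∷ M)  (suc k) =
  trans (∑-branch (subsetsOf M) (subsetsOf M) _)
    (trans (cong₂ _+_ (∑-size≡C M (suc k)) (∑-size≡C M k))
      (trans (+-comm (∣ M ∣ C suc k) _) (nCk+nC[k+1]≡[n+1]C[k+1] ∣ M ∣ k)))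

-- shifted m t k is the coefficient of x^k in x^t (1+x)^m.
shifted : ℕ → ℕ → ℕ → ℕ
shifted m zero    k       = m C k
shifted m (suc t) zero    = 0
shifted m (suc t) (suc k) = shifted m t k

∑-size≡shifted : ∀ {n} (M : Subset n) (t k : ℕ) →
  ∑[ B ← subsetsOf M ] 𝟙 (t + ∣ B ∣ ≟ k) ≡ shifted ∣ M ∣ t k
∑-size≡shifted M zero    k       = ∑-size≡C M k
∑-size≡shifted M (suc t) zero    = ∑-zero (subsetsOf M) (λ _ → refl)
∑-size≡shifted M (suc t) (suc k) = ∑-size≡shifted M t k

Palindromic : (ℕ → ℕ) → ℕ → Set
Palindromic c d = ∀ k → k ≤ d → c k ≡ c (d ∸ k)

AscendingToCentre : (ℕ → ℕ) → ℕ → Set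
AscendingToCentre c d = ∀ k → suc (k + k) ≤ d → c k ≤ c (suc k)

VanishesAbove : (ℕ → ℕ) → ℕ → Set
VanishesAbove c d = ∀ k → d < k → c k ≡ 0

UnimodalUpTo : (ℕ → ℕ) → ℕ → Set
UnimodalUpTo c d = ∃[ m ] (m ≤ d
  × (∀ k → suc k ≤ m → c k ≤ c (suc k))
  × (∀ k → m ≤ k → suc k ≤ d → c (suc k) ≤ c k))

when : {P : Set} → Dec P → (ℕ → ℕ) → ℕ → ℕ
when p c = if does p then c else λ _ → 0

when-preserves : {P : Set} (Q : (ℕ → ℕ) → Set) {c : ℕ → ℕ} →
  Q (λ _ → 0) → (P → Q c) → (p : Dec P) → Q (when p c)
when-preserves Q Q0 Qc (yes p) = Qc p
when-preserves Q Q0 Qc (no _)  = Q0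

module _ {A : Set} (xs : List A) {c : A → ℕ → ℕ} {d : ℕ} where

  ∑-palindromic : (∀ {x} → x ∈L xs → Palindromic (c x) d) → Palindromic (λ k → ∑[ x ← xs ] c x k) d
  ∑-palindromic pal k k≤d = ∑-cong xs (λ x∈ → pal x∈ k k≤d)

  ∑-ascending : (∀ {x} → x ∈L xs → AscendingToCentre (c x) d) →
    AscendingToCentre (λ k → ∑[ x ← xs ] c x k) d
  ∑-ascending asc k 2k<d = ∑-mono xs (λ x∈ → asc x∈ k 2k<d)

  ∑-vanishes : (∀ {x} → x ∈L xs → VanishesAbove (c x) d) → VanishesAbove (λ k → ∑[ x ← xs ] c x k) d
  ∑-vanishes van k d<k = trans (∑-cong xs (λ x∈ → van x∈ k d<k)) (∑-zero xs (λ _ → refl))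

⌊d/2⌋-double≤d : ∀ d → ⌊ d /2⌋ + ⌊ d /2⌋ ≤ d
⌊d/2⌋-double≤d d = subst (⌊ d /2⌋ + ⌊ d /2⌋ ≤_) (⌊n/2⌋+⌈n/2⌉≡n d) (+-monoʳ-≤ ⌊ d /2⌋ (⌊n/2⌋≤⌈n/2⌉ d))

d≤⌊d/2⌋-double+1 : ∀ d → d ≤ suc (⌊ d /2⌋ + ⌊ d /2⌋)
d≤⌊d/2⌋-double+1 zero          = z≤n
d≤⌊d/2⌋-double+1 (suc zero)    = s≤s z≤n
d≤⌊d/2⌋-double+1 (suc (suc d)) =
  s≤s (subst (suc d ≤_) (sym (cong suc (+-suc ⌊ d /2⌋ ⌊ d /2⌋))) (s≤s (d≤⌊d/2⌋-double+1 d)))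

-- A palindromic sequence ascending to its centre is unimodal with mode ⌊d/2⌋:
-- the descent above the centre is the mirror image of the ascent below it.
palindromic-ascending⇒unimodal : ∀ {c d} → Palindromic c d → AscendingToCentre c d → UnimodalUpTo c d
palindromic-ascending⇒unimodal {c} {d} pal asc = ⌊ d /2⌋ , ⌊n/2⌋≤n d , ascent , descent
  where
  ascent : ∀ k → suc k ≤ ⌊ d /2⌋ → c k ≤ c (suc k)
  ascent k k<half = asc k (≤-trans (s≤s (+-monoʳ-≤ k (n≤1+n k)))
                                   (≤-trans (+-mono-≤ k<half k<half) (⌊d/2⌋-double≤d d)))

  descent : ∀ k → ⌊ d /2⌋ ≤ k → suc k ≤ d → c (suc k) ≤ c k
  descent k half≤k k<d = subst₂ _≤_ (sym (pal (suc k) k<d)) mirror (asc j 2j<d)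
    where
    j : ℕ
    j = d ∸ suc k
    k+1+j≡d : suc k + j ≡ d
    k+1+j≡d = m+[n∸m]≡n k<d
    j≤k : j ≤ k
    j≤k = +-cancelˡ-≤ (suc k) j k (subst (_≤ suc (k + k)) (sym k+1+j≡d)
            (≤-trans (d≤⌊d/2⌋-double+1 d) (s≤s (+-mono-≤ half≤k half≤k))))
    2j<d : suc (j + j) ≤ d
    2j<d = subst (suc (j + j) ≤_) k+1+j≡d (s≤s (+-monoˡ-≤ j j≤k))
    mirror : c (suc j) ≡ c k
    mirror = begin
        c (suc j)    ≡⟨ cong c (+-∸-assoc 1 k<d) ⟨
        c (d ∸ k)    ≡⟨ pal k (≤-trans (n≤1+n k) k<d) ⟨
        c k          ∎
      where open ≡-Reasoning

-- Binomial coefficients ascend to the centre: use Pascal's rule and induction,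
-- with symmetry handling the step that reaches the centre exactly.
C-ascending : ∀ m → AscendingToCentre (m C_) m
C-ascending (suc m) zero    _ = subst (1 ≤_) (sym (nC1≡n (suc m))) (s≤s z≤n)
C-ascending (suc m) (suc j) 2j+3≤m+1 with m≤n⇒m<n∨m≡n 2j+2≤m
  where
  2j+2≤m : suc (suc (j + j)) ≤ m
  2j+2≤m = subst (_≤ m) (cong suc (+-suc j j)) (≤-pred 2j+3≤m+1)
... | inj₁ 2j+3≤m = begin
    suc m C suc j                 ≡⟨ nCk+nC[k+1]≡[n+1]C[k+1] m j ⟨
    m C j + m C suc j             ≤⟨ +-mono-≤ (C-ascending m j (≤-trans (n≤1+n _) (<⇒≤ 2j+3≤m)))
                                              (C-ascending m (suc j) (subst (_≤ m) 2j+3≡ 2j+3≤m)) ⟩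
    m C suc j + m C suc (suc j)   ≡⟨ nCk+nC[k+1]≡[n+1]C[k+1] m (suc j) ⟩
    suc m C suc (suc j)           ∎
  where
  open ≤-Reasoning
  2j+3≡ : suc (suc (suc (j + j))) ≡ suc (suc j + suc j)
  2j+3≡ = cong (suc ∘ suc) (sym (+-suc j j))
... | inj₂ refl = ≤-reflexive (begin
    suc m C suc j                 ≡⟨ nCk+nC[k+1]≡[n+1]C[k+1] m j ⟨
    m C j + m C suc j             ≡⟨ +-comm (m C j) _ ⟩
    m C suc j + m C j             ≡⟨ cong (m C suc j +_) centre-mirror ⟩
    m C suc j + m C suc (suc j)   ≡⟨ nCk+nC[k+1]≡[n+1]C[k+1] m (suc j) ⟩
    suc m C suc (suc j)           ∎)
  where
  open ≡-Reasoning
  centre-mirror : m C j ≡ m C suc (suc j)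
  centre-mirror = trans (cong (m C_) (sym (m+n∸n≡m j j)))
                        (sym (nCk≡nC[n∸k] (s≤s (s≤s (m≤n+m j j)))))

shifted-vanishes : ∀ m t → VanishesAbove (shifted m t) (m + t)
shifted-vanishes m zero    k       m<k = k>n⇒nCk≡0 (subst (_< k) (+-identityʳ m) m<k)
shifted-vanishes m (suc t) (suc k) m+t<k =
  shifted-vanishes m t k (≤-pred (subst (_< suc k) (+-suc m t) m+t<k))

degree-suc : ∀ m t → m + (suc t + suc t) ≡ suc (suc (m + (t + t)))
degree-suc m t = trans (+-suc m (t + suc t)) (cong suc (trans (cong (m +_) (+-suc t t)) (+-suc m (t + t))))

-- x^t (1+x)^m is palindromic about m + 2t: the zeros below x^t mirror the
-- zeros above x^(m+t).
shifted-palindromic : ∀ m t → Palindromic (shifted m t) (m + (t + t))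
shifted-palindromic m zero k k≤m rewrite +-identityʳ m = nCk≡nC[n∸k] k≤m
shifted-palindromic m (suc t) k k≤d rewrite degree-suc m t = mirror k k≤d
  where
  D : ℕ
  D = m + (t + t)
  top-vanishes : shifted m t (suc D) ≡ 0
  top-vanishes = shifted-vanishes m t (suc D) (s≤s (+-monoʳ-≤ m (m≤m+n t t)))
  mirror : ∀ k → k ≤ suc (suc D) → shifted m (suc t) k ≡ shifted m (suc t) (suc (suc D) ∸ k)
  mirror zero          _       = sym top-vanishes
  mirror (suc k) (s≤s k≤D+1) with m≤n⇒m<n∨m≡n k≤D+1
  ... | inj₁ (s≤s k≤D) rewrite +-∸-assoc 1 k≤D = shifted-palindromic m t k k≤D
  ... | inj₂ refl      rewrite n∸n≡0 D         = top-vanishes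

-- The factor x^t only shifts the ascending binomial coefficients towards the centre.
shifted-ascending : ∀ m t → AscendingToCentre (shifted m t) (m + (t + t))
shifted-ascending m zero    k       2k<m rewrite +-identityʳ m = C-ascending m k 2k<m
shifted-ascending m (suc t) zero    _    = z≤n
shifted-ascending m (suc t) (suc k) 2k<d rewrite degree-suc m t | +-suc k k =
  shifted-ascending m t k (≤-pred (≤-pred 2k<d))

∣∪∣-separated : ∀ {n} (A B S : Subset n) → A ⊆ ∁ S → B ⊆ S → ∣ A ∪ B ∣ ≡ ∣ A ∣ + ∣ B ∣
∣∪∣-separated []      []      []      _ _ = refl
∣∪∣-separated (_ ∷ A) (_ ∷ B) (_ ∷ S) A⊆ B⊆ with ∣∪∣-separated A B S (drop-∷-⊆ A⊆) (drop-∷-⊆ B⊆)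
∣∪∣-separated (outside ∷ A) (outside ∷ B) _ _ _ | ih = ih
∣∪∣-separated (inside ∷ A)  (outside ∷ B) _ _ _ | ih = cong suc ih
∣∪∣-separated (outside ∷ A) (inside ∷ B)  _ _ _ | ih = trans (cong suc ih) (sym (+-suc _ _))
∣∪∣-separated (inside ∷ A)  (inside ∷ B) (inside ∷ S)  A⊆ B⊆ | _ with A⊆ head∈
... | ()
∣∪∣-separated (inside ∷ A)  (inside ∷ B) (outside ∷ S) A⊆ B⊆ | _ with B⊆ head∈
... | ()

∣p∩∁r∣+∣r∩p∣≡∣p∣ : ∀ {n} (P R : Subset n) → ∣ P ∩ ∁ R ∣ + ∣ R ∩ P ∣ ≡ ∣ P ∣
∣p∩∁r∣+∣r∩p∣≡∣p∣ []            []            = refl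
∣p∩∁r∣+∣r∩p∣≡∣p∣ (inside ∷ P)  (inside ∷ R)  = trans (+-suc _ _) (cong suc (∣p∩∁r∣+∣r∩p∣≡∣p∣ P R))
∣p∩∁r∣+∣r∩p∣≡∣p∣ (inside ∷ P)  (outside ∷ R) = cong suc (∣p∩∁r∣+∣r∩p∣≡∣p∣ P R)
∣p∩∁r∣+∣r∩p∣≡∣p∣ (outside ∷ P) (inside ∷ R)  = ∣p∩∁r∣+∣r∩p∣≡∣p∣ P R
∣p∩∁r∣+∣r∩p∣≡∣p∣ (outside ∷ P) (outside ∷ R) = ∣p∩∁r∣+∣r∩p∣≡∣p∣ P R

module _ {n} (G : Graph n) where

  ∈N⁺ : ∀ {A u v} → u ∈ A → Adj G u v → v ∈ N G A
  ∈N⁺ {A} {u} {v} u∈A uv = lookup⇒[]= v (N G A) (trans (lookup∘tabulate _ v) (witnessed (any? _)))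
    where
    witnessed : (d : Dec (∃[ w ] (w ∈ A × Adj G w v))) → does d ≡ true
    witnessed (yes _) = refl
    witnessed (no ¬∃) = contradiction (u , u∈A , uv) ¬∃

  ∈N⁻ : ∀ {A v} → v ∈ N G A → ∃[ u ] (u ∈ A × Adj G u v)
  ∈N⁻ {A} {v} v∈N = witness (any? _) (trans (sym (lookup∘tabulate _ v)) ([]=⇒lookup v∈N))
    where
    witness : (d : Dec (∃[ u ] (u ∈ A × Adj G u v))) → does d ≡ true → ∃[ u ] (u ∈ A × Adj G u v)
    witness (yes ∃u) _ = ∃u

module IndependentSetCount {n} (G : Graph n) (S : Subset n) (S-independent : Independent G S)
  (doubling : ∀ (A : Subset n) → A ⊆ ∁ S → Independent G A → ∣ N G A ∩ S ∣ ≡ 2 * ∣ A ∣) where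

  s : ℕ
  s = ∣ S ∣

  counted : ℕ → Subset n → ℕ
  counted k X = 𝟙 (independent? G X ×-dec (∣ X ∣ ≟ k))

  ∪-independent : ∀ {A B} → Independent G A → B ⊆ S → B ⊆ ∁ (N G A) → Independent G (A ∪ B)
  ∪-independent {A} {B} A-ind B⊆S B-avoids u v u∈ v∈ uv with x∈p∪q⁻ A B u∈ | x∈p∪q⁻ A B v∈
  ... | inj₁ u∈A | inj₁ v∈A = A-ind u v u∈A v∈A uv
  ... | inj₂ u∈B | inj₂ v∈B = S-independent u v (B⊆S u∈B) (B⊆S v∈B) uv
  ... | inj₁ u∈A | inj₂ v∈B = x∈∁p⇒x∉p (B-avoids v∈B) (∈N⁺ G u∈A uv)
  ... | inj₂ u∈B | inj₁ v∈A = x∈∁p⇒x∉p (B-avoids u∈B) (∈N⁺ G v∈A (trans (Graph.sym G v u) uv))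

  ∪-independent⇒avoids : ∀ {A B} → Independent G (A ∪ B) → B ⊆ ∁ (N G A)
  ∪-independent⇒avoids {A} {B} X-ind {v} v∈B = x∉p⇒x∈∁p λ v∈N →
    let (u , u∈A , uv) = ∈N⁻ G v∈N in X-ind u v (p⊆p∪q B u∈A) (q⊆p∪q A B v∈B) uv

  counted-∪ : ∀ k {A B} → A ⊆ ∁ S → B ⊆ S → Independent G A →
    counted k (A ∪ B) ≡ (if does (B ⊆? ∁ (N G A)) then 𝟙 (∣ A ∣ + ∣ B ∣ ≟ k) else 0)
  counted-∪ k {A} {B} A⊆∁S B⊆S A-ind with B ⊆? ∁ (N G A)
  ... | yes B-avoids = 𝟙-cong (λ (_ , size) → trans (sym ∣A∪B∣) size)
                              (λ size → ∪-independent A-ind B⊆S B-avoids , trans ∣A∪B∣ size)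
                              (independent? G (A ∪ B) ×-dec (∣ A ∪ B ∣ ≟ k)) (∣ A ∣ + ∣ B ∣ ≟ k)
    where
    ∣A∪B∣ : ∣ A ∪ B ∣ ≡ ∣ A ∣ + ∣ B ∣
    ∣A∪B∣ = ∣∪∣-separated A B S A⊆∁S B⊆S
  ... | no ¬avoids = 𝟙-false (λ (X-ind , _) → ¬avoids (∪-independent⇒avoids X-ind))
                             (independent? G (A ∪ B) ×-dec (∣ A ∪ B ∣ ≟ k))

  counted-dependent : ∀ k {A B} → ¬ Independent G A → counted k (A ∪ B) ≡ 0
  counted-dependent k {A} {B} ¬A-ind =
    𝟙-false (λ (X-ind , _) → ¬A-ind (λ u v u∈ v∈ → X-ind u v (p⊆p∪q B u∈) (p⊆p∪q B v∈)))
            (independent? G (A ∪ B) ×-dec (∣ A ∪ B ∣ ≟ k))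

  2∣A∣≤s : ∀ {A} → A ⊆ ∁ S → Independent G A → 2 * ∣ A ∣ ≤ s
  2∣A∣≤s {A} A⊆∁S A-ind = subst (_≤ s) (doubling A A⊆∁S A-ind) (∣p∩q∣≤∣q∣ (N G A) S)

  ∣S∖N∣ : ∀ {A} → A ⊆ ∁ S → Independent G A → ∣ S ∩ ∁ (N G A) ∣ ≡ s ∸ 2 * ∣ A ∣
  ∣S∖N∣ {A} A⊆∁S A-ind = begin
      ∣ S ∩ ∁ (N G A) ∣                               ≡⟨ m+n∸n≡m _ (2 * ∣ A ∣) ⟨
      ∣ S ∩ ∁ (N G A) ∣ + 2 * ∣ A ∣ ∸ 2 * ∣ A ∣       ≡⟨ cong (λ x → ∣ S ∩ ∁ (N G A) ∣ + x ∸ 2 * ∣ A ∣)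
                                                            (doubling A A⊆∁S A-ind) ⟨
      ∣ S ∩ ∁ (N G A) ∣ + ∣ N G A ∩ S ∣ ∸ 2 * ∣ A ∣  ≡⟨ cong (_∸ 2 * ∣ A ∣) (∣p∩∁r∣+∣r∩p∣≡∣p∣ S (N G A)) ⟩
      s ∸ 2 * ∣ A ∣                                   ∎
    where open ≡-Reasoning

  centre≡s : ∀ {A} → A ⊆ ∁ S → Independent G A → s ∸ 2 * ∣ A ∣ + (∣ A ∣ + ∣ A ∣) ≡ s
  centre≡s {A} A⊆∁S A-ind =
    trans (cong (s ∸ 2 * ∣ A ∣ +_) (cong (∣ A ∣ +_) (sym (+-identityʳ ∣ A ∣))))
          (m∸n+n≡m (2∣A∣≤s A⊆∁S A-ind))

  contribution : Subset n → ℕ → ℕ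
  contribution A = when (independent? G A) (shifted (s ∸ 2 * ∣ A ∣) ∣ A ∣)

  ∑-extensions : ∀ k {A} → A ⊆ ∁ S → ∑[ B ← subsetsOf S ] counted k (A ∪ B) ≡ contribution A k
  ∑-extensions k {A} A⊆∁S = extend (independent? G A)
    where
    extend : (p : Dec (Independent G A)) →
      ∑[ B ← subsetsOf S ] counted k (A ∪ B) ≡ when p (shifted (s ∸ 2 * ∣ A ∣) ∣ A ∣) k
    extend (no ¬A-ind) = ∑-zero (subsetsOf S) (λ _ → counted-dependent k ¬A-ind)
    extend (yes A-ind) = begin
        ∑[ B ← subsetsOf S ] counted k (A ∪ B)
      ≡⟨ ∑-cong (subsetsOf S) (λ B∈ → counted-∪ k A⊆∁S (∈subsetsOf⇒⊆ S B∈) A-ind) ⟩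
        ∑[ B ← subsetsOf S ] (if does (B ⊆? ∁ (N G A)) then 𝟙 (∣ A ∣ + ∣ B ∣ ≟ k) else 0)
      ≡⟨ ∑-restrict S (∁ (N G A)) _ ⟩
        ∑[ B ← subsetsOf (S ∩ ∁ (N G A)) ] 𝟙 (∣ A ∣ + ∣ B ∣ ≟ k)
      ≡⟨ ∑-size≡shifted (S ∩ ∁ (N G A)) (∣ A ∣) k ⟩
        shifted ∣ S ∩ ∁ (N G A) ∣ (∣ A ∣) k
      ≡⟨ cong (λ m → shifted m (∣ A ∣) k) (∣S∖N∣ A⊆∁S A-ind) ⟩
        shifted (s ∸ 2 * ∣ A ∣) (∣ A ∣) k
      ∎ where open ≡-Reasoning

  indepCount-formula : ∀ k → indepCount G k ≡ ∑[ A ← subsetsOf (∁ S) ] contribution A k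
  indepCount-formula k = begin
      indepCount G k
    ≡⟨ length-filter≡∑𝟙 _ (allSubsets n) ⟩
      ∑ (allSubsets n) (counted k)
    ≡⟨ ∑-decompose S (counted k) ⟩
      ∑[ A ← subsetsOf (∁ S) ] ∑[ B ← subsetsOf S ] counted k (A ∪ B)
    ≡⟨ ∑-cong (subsetsOf (∁ S)) (λ A∈ → ∑-extensions k (∈subsetsOf⇒⊆ (∁ S) A∈)) ⟩
      ∑[ A ← subsetsOf (∁ S) ] contribution A k
    ∎ where open ≡-Reasoning

  module _ {A : Subset n} (A∈ : A ∈L subsetsOf (∁ S)) where

    private
      m : ℕ
      m = s ∸ 2 * ∣ A ∣
      centre : Independent G A → m + (∣ A ∣ + ∣ A ∣) ≡ s
      centre = centre≡s (∈subsetsOf⇒⊆ (∁ S) A∈)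

    contribution-palindromic : Palindromic (contribution A) s
    contribution-palindromic = when-preserves (λ c → Palindromic c s) (λ _ _ → refl)
      (λ A-ind → subst (Palindromic _) (centre A-ind) (shifted-palindromic m ∣ A ∣)) (independent? G A)

    contribution-ascending : AscendingToCentre (contribution A) s
    contribution-ascending = when-preserves (λ c → AscendingToCentre c s) (λ _ _ → z≤n)
      (λ A-ind → subst (AscendingToCentre _) (centre A-ind) (shifted-ascending m ∣ A ∣)) (independent? G A)

    contribution-vanishes : VanishesAbove (contribution A) s
    contribution-vanishes = when-preserves (λ c → VanishesAbove c s) (λ _ _ → refl)
      (λ A-ind k s<k → shifted-vanishes m ∣ A ∣ k
        (≤-<-trans (≤-trans (+-monoʳ-≤ m (m≤m+n ∣ A ∣ ∣ A ∣)) (≤-reflexive (centre A-ind))) s<k))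
      (independent? G A)

  indepCount-palindromic : Palindromic (indepCount G) s
  indepCount-palindromic k k≤s =
    trans (indepCount-formula k)
      (trans (∑-palindromic (subsetsOf (∁ S)) contribution-palindromic k k≤s)
        (sym (indepCount-formula (s ∸ k))))

  indepCount-ascending : AscendingToCentre (indepCount G) s
  indepCount-ascending k 2k<s =
    subst₂ _≤_ (sym (indepCount-formula k)) (sym (indepCount-formula (suc k)))
      (∑-ascending (subsetsOf (∁ S)) contribution-ascending k 2k<s)

  indepCount-vanishes : VanishesAbove (indepCount G) s
  indepCount-vanishes k s<k =
    trans (indepCount-formula k) (∑-vanishes (subsetsOf (∁ S)) contribution-vanishes k s<k)

  -- Each independent set X is counted in indepCount G |X|, which therefore is nonzero.
  independent⇒size≤s : ∀ X → Independent G X → ∣ X ∣ ≤ s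
  independent⇒size≤s X X-ind with ∣ X ∣ ≤? s
  ... | yes ∣X∣≤s = ∣X∣≤s
  ... | no ∣X∣≰s  = contradiction (indepCount-vanishes ∣ X ∣ (≰⇒> ∣X∣≰s))
      (>⇒≢ (filter-some (λ A → independent? G A ×-dec (∣ A ∣ ≟ ∣ X ∣)) (lose (∈allSubsets X) (X-ind , refl))))

  α≡s : α G ≡ s
  α≡s = ≤-antisym
    (maxOver-least ∣_∣ independentSets λ X∈ →
      independent⇒size≤s _ (proj₂ (∈-filter⁻ (independent? G) {xs = allSubsets n} X∈)))
    (maxOver-upper ∣_∣ independentSets (∈-filter⁺ (independent? G) (∈allSubsets S) S-independent))
    where
    independentSets : List (Subset n)
    independentSets = filter (independent? G) (allSubsets n)

theorem3p5 : ∀ {n} (G : Graph n) →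
    (∃[ S ] (Independent G S ×
      (∀ (A : Subset n) → A ⊆ ∁ S → Independent G A →
        ∣ N G A ∩ S ∣ ≡ 2 * ∣ A ∣))) →
    Symmetric G × Unimodal G
theorem3p5 G (S , S-independent , doubling) =
  symmetric , palindromic-ascending⇒unimodal symmetric ascending
  where
  open IndependentSetCount G S S-independent doubling
  symmetric : Palindromic (indepCount G) (α G)
  symmetric = subst (Palindromic (indepCount G)) (sym α≡s) indepCount-palindromic
  ascending : AscendingToCentre (indepCount G) (α G)
  ascending = subst (AscendingToCentre (indepCount G)) (sym α≡s) indepCount-ascending
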